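{- Let $A\subseteq\{0,1\}^k$ be a predicate with no forced $1$-bit. If $\mathrm{Pol}(\mathrm{fPCSP}(A,\mathrm{OR}))$ contains infinitely many functions from $\{\mathrm{id}(\neg\mathrm{Par}_\ell):\ell\text{ odd}\}$, then it also contains infinitely many functions from $\{\neg\mathrm{Par}_\ell:\ell\text{ odd}\}$.
   Context: A predicate is a set $\emptyset\ne A\subsetneq\{0,1\}^k$; $\mathrm{OR}=\{0,1\}^k\setminus\{0^k\}$. $A$ has a forced $1$-bit if there is $i\in[k]$ with $a_i=1$ for all $a\in A$. A function $f:\{0,1\}^\ell\to\{0,1\}$ is a polymorphism of $\mathrm{PCSP}(A,B)$ if for every $k\times\ell$ matrix $M$ whose columns lie in $A$, the vector of values of $f$ on the rows of $M$ lies in $B$; $\mathrm{Pol}(\mathrm{fPCSP}(A,B))$ is the set of such polymorphisms that are folded ($f(\neg x)=\neg f(x)$). $\mathrm{Par}_\ell(x)=x_1\oplus\cdots\oplus x_\ell$. For $f:\{0,1\}^\ell\to\{0,1\}$, $\mathrm{id}f$ equals $0$ at $0^\ell$, $1$ at $1^\ell$, and $f(x)$ otherwise. -}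

module Defs where

open import Data.Bool using (Bool; true; false; not; _xor_; _∧_; _∨_; T)
open import Data.Nat using (ℕ; zero; suc; _≤_; _+_)
open import Data.Fin using (Fin)
open import Data.Product using (Σ; ∃; _×_)
open import Relation.Binary.PropositionalEquality using (_≡_)
open import Relation.Nullary using (¬_)

Odd : ℕ → Set
Odd ℓ = Σ ℕ λ m → ℓ ≡ suc (m + m)

BitVec : ℕ → Set
BitVec n = Fin n → Bool

Subset01 : ℕ → Set
Subset01 k = BitVec k → Bool

IsPredicate : {k : ℕ} → Subset01 k → Set
IsPredicate {k} A = (Σ (BitVec k) λ a → T (A a)) × (Σ (BitVec k) λ a → ¬ T (A a))

anyTrue : (n : ℕ) → BitVec n → Bool
anyTrue zero    x = false
anyTrue (suc n) x = x Data.Fin.zero ∨ anyTrue n (λ i → x (Data.Fin.suc i))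

allTrue : (n : ℕ) → BitVec n → Bool
allTrue zero    x = true
allTrue (suc n) x = x Data.Fin.zero ∧ allTrue n (λ i → x (Data.Fin.suc i))

OR : (k : ℕ) → Subset01 k
OR k = anyTrue k

HasForced1 : {k : ℕ} → Subset01 k → Set
HasForced1 {k} A = Σ (Fin k) λ i → (a : BitVec k) → T (A a) → a i ≡ true

IsPolymorphism : {k : ℕ} → Subset01 k → Subset01 k → (ℓ : ℕ) → (BitVec ℓ → Bool) → Set
IsPolymorphism {k} A B ℓ f =
  (M : Fin k → Fin ℓ → Bool) →
  ((j : Fin ℓ) → T (A (λ i → M i j))) →
  T (B (λ i → f (M i)))

Folded : (ℓ : ℕ) → (BitVec ℓ → Bool) → Set
Folded ℓ f = (x : BitVec ℓ) → f (λ i → not (x i)) ≡ not (f x)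

InPolF : {k : ℕ} → Subset01 k → Subset01 k → (ℓ : ℕ) → (BitVec ℓ → Bool) → Set
InPolF A B ℓ f = IsPolymorphism A B ℓ f × Folded ℓ f

Par : (ℓ : ℕ) → BitVec ℓ → Bool
Par zero    x = false
Par (suc ℓ) x = x Data.Fin.zero xor Par ℓ (λ i → x (Data.Fin.suc i))

NotPar : (ℓ : ℕ) → BitVec ℓ → Bool
NotPar ℓ x = not (Par ℓ x)

idF : (ℓ : ℕ) → (BitVec ℓ → Bool) → BitVec ℓ → Bool
idF ℓ f x with anyTrue ℓ x | allTrue ℓ x
... | false | _    = false
... | true  | true = true
... | true  | false = f x

-- Pad a k × ℓ matrix M with columns in A by k pairs of equal columns a⁽ⁱ⁾ ∈ A, where a⁽ⁱ⁾ has a 0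
-- in coordinate i; such columns exist because A has no forced 1-bit (constructively only under
-- ¬¬, which suffices since the OR-condition is decidable). Each pair cancels in the parity, so
-- every row keeps its parity, and row i now contains a 0, so id(¬Par) agrees with ¬Par on it:
-- the OR-condition for id(¬Par_{2k+ℓ}) on the padded matrix gives that for ¬Par_ℓ on M.
-- Foldedness of ¬Par_ℓ only needs ℓ odd.
{-# OPTIONS --safe #-}
module Submission where

open import Defs
open import Algebra.Bundles using (CommutativeRing)
open import Data.Bool using (Bool; true; false; not; _∧_; _xor_; T)
open import Data.Bool.Properties
  using (xor-∧-commutativeRing; xor-assoc; xor-same; not-involutive; ¬-not; ∧-zeroʳ; T-∨)
open import Data.Fin using (Fin; zero; suc)
open import Data.Fin.Properties using (sequence)
open import Data.Nat using (ℕ; zero; suc; _+_; _*_; _≤_)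
open import Data.Nat.Properties using (+-suc; +-assoc; suc-injective; m≤m+n; m≤n⇒∃[o]m+o≡n)
open import Data.Product using (Σ; ∃-syntax; _×_; _,_; proj₁; proj₂)
open import Data.Sum using () renaming (map to ⊎-map)
open import Data.Vec.Functional using (_∷_)
open import Effect.Monad using (RawMonad)
open import Function using (_∘_; Equivalence)
open import Relation.Binary.PropositionalEquality
  using (_≡_; refl; sym; trans; cong; subst; module ≡-Reasoning)
open import Relation.Nullary using (¬_)
open import Relation.Nullary.Decidable using (decidable-stable; T?)
open import Relation.Nullary.Negation using (¬¬-Monad; ¬¬-map)

open import Algebra.Properties.CommutativeSemigroup
  (CommutativeRing.+-commutativeSemigroup xor-∧-commutativeRing) using (interchange)

ones : (n : ℕ) → BitVec n
ones n _ = true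

Par-xor : ∀ n (x y : BitVec n) → Par n (λ i → x i xor y i) ≡ Par n x xor Par n y
Par-xor zero    x y = refl
Par-xor (suc n) x y = trans (cong ((x zero xor y zero) xor_) (Par-xor n (x ∘ suc) (y ∘ suc)))
                            (interchange (x zero) (y zero) _ _)

Par-ones-+ : ∀ m n → Par (m + n) (ones (m + n)) ≡ Par m (ones m) xor Par n (ones n)
Par-ones-+ zero    n = refl
Par-ones-+ (suc m) n =
  trans (cong not (Par-ones-+ m n)) (sym (xor-assoc true (Par m (ones m)) (Par n (ones n))))

Par-ones-odd : ∀ {n} → Odd n → Par n (ones n) ≡ true
Par-ones-odd (m , refl) = cong not (trans (Par-ones-+ m m) (xor-same (Par m (ones m))))

NotPar-folded : ∀ {ℓ} → Odd ℓ → Folded ℓ (NotPar ℓ)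
NotPar-folded {ℓ} ℓ-odd x = cong not (begin
  Par ℓ (not ∘ x)              ≡⟨ Par-xor ℓ (ones ℓ) x ⟩
  Par ℓ (ones ℓ) xor Par ℓ x   ≡⟨ cong (_xor Par ℓ x) (Par-ones-odd ℓ-odd) ⟩
  not (Par ℓ x)                ∎)
  where open ≡-Reasoning

Par-double : ∀ {n} b (x : BitVec n) → Par (2 + n) (b ∷ b ∷ x) ≡ Par n x
Par-double true  x = not-involutive _
Par-double false x = refl

Odd-suc-suc⁻ : ∀ {n} → Odd (2 + n) → Odd n
Odd-suc-suc⁻ (zero  , ())
Odd-suc-suc⁻ (suc m , e) = m , trans (suc-injective (suc-injective e)) (+-suc m m)

Odd-*2+⁻ : ∀ m {n} → Odd (m * 2 + n) → Odd n
Odd-*2+⁻ zero    odd = odd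
Odd-*2+⁻ (suc m) odd = Odd-*2+⁻ m (Odd-suc-suc⁻ odd)

+-≤-split : ∀ m {n o} → m + n ≤ o → ∃[ o′ ] o ≡ m + o′ × n ≤ o′
+-≤-split m {n} m+n≤o with m≤n⇒∃[o]m+o≡n m+n≤o
... | d , refl = n + d , +-assoc m n d , m≤m+n n d

allTrue-false : ∀ {n} (x : BitVec n) j → x j ≡ false → allTrue n x ≡ false
allTrue-false x zero    xj≡false = cong (_∧ allTrue _ (x ∘ suc)) xj≡false
allTrue-false x (suc j) xj≡false =
  trans (cong (x zero ∧_) (allTrue-false (x ∘ suc) j xj≡false)) (∧-zeroʳ (x zero))

anyTrue-mono : ∀ {n} {x y : BitVec n} → (∀ i → T (x i) → T (y i)) →
  T (anyTrue n x) → T (anyTrue n y)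
anyTrue-mono {zero}          x⇒y ()
anyTrue-mono {suc n} {x} {y} x⇒y t =
  Equivalence.from (T-∨ {y zero} {anyTrue n (y ∘ suc)})
    (⊎-map (x⇒y zero) (anyTrue-mono (x⇒y ∘ suc))
      (Equivalence.to (T-∨ {x zero} {anyTrue n (x ∘ suc)}) t))

T-idF⇒T : ∀ ℓ (f : BitVec ℓ → Bool) x → allTrue ℓ x ≡ false → T (idF ℓ f x) → T (f x)
T-idF⇒T ℓ f x notAll t with anyTrue ℓ x | allTrue ℓ x
T-idF⇒T ℓ f x notAll () | false | _
T-idF⇒T ℓ f x ()     t  | true  | true
T-idF⇒T ℓ f x notAll t  | true  | false = t

pad-index : ∀ {n ℓ} → Fin n → Fin (n * 2 + ℓ)
pad-index zero    = zero
pad-index (suc j) = suc (suc (pad-index j))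

module _ {k : ℕ} where

  pad : ∀ {n ℓ} → (Fin n → BitVec k) → (Fin k → BitVec ℓ) → Fin k → BitVec (n * 2 + ℓ)
  pad {zero}  d M i = M i
  pad {suc n} d M i = d zero i ∷ d zero i ∷ pad (d ∘ suc) M i

  pad-columns : ∀ {n ℓ} (P : BitVec k → Set) (d : Fin n → BitVec k) (M : Fin k → BitVec ℓ) →
    (∀ j → P (d j)) → (∀ j → P (λ i → M i j)) → ∀ j → P (λ i → pad d M i j)
  pad-columns {zero}  P d M Pd PM j             = PM j
  pad-columns {suc n} P d M Pd PM zero          = Pd zero
  pad-columns {suc n} P d M Pd PM (suc zero)    = Pd zero
  pad-columns {suc n} P d M Pd PM (suc (suc j)) = pad-columns P (d ∘ suc) M (Pd ∘ suc) PM j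

  Par-pad : ∀ {n ℓ} (d : Fin n → BitVec k) (M : Fin k → BitVec ℓ) i →
    Par (n * 2 + ℓ) (pad d M i) ≡ Par ℓ (M i)
  Par-pad {zero}  d M i = refl
  Par-pad {suc n} d M i = trans (Par-double (d zero i) (pad (d ∘ suc) M i)) (Par-pad (d ∘ suc) M i)

  pad-at-index : ∀ {n ℓ} (d : Fin n → BitVec k) (M : Fin k → BitVec ℓ) i j →
    pad d M i (pad-index j) ≡ d j i
  pad-at-index d M i zero    = refl
  pad-at-index d M i (suc j) = pad-at-index (d ∘ suc) M i j

ZeroAt : ∀ {k} → Subset01 k → Fin k → Set
ZeroAt A i = ∃[ a ] T (A a) × a i ≡ false

¬¬-ZeroAt-everywhere : ∀ {k} {A : Subset01 k} → ¬ HasForced1 A → ¬ ¬ (∀ i → ZeroAt A i)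
¬¬-ZeroAt-everywhere unforced =
  sequence (RawMonad.rawApplicative ¬¬-Monad)
    (λ i noZero → unforced (i , λ a a∈A → ¬-not (λ ai≡false → noZero (a , a∈A , ai≡false))))

NotPar-polymorphism : ∀ {k} {A : Subset01 k} ℓ → ¬ HasForced1 A →
  IsPolymorphism A (OR k) (k * 2 + ℓ) (idF (k * 2 + ℓ) (NotPar (k * 2 + ℓ))) →
  IsPolymorphism A (OR k) ℓ (NotPar ℓ)
NotPar-polymorphism {k} {A} ℓ unforced idPol M M∈A =
  decidable-stable (T? (OR k (λ i → NotPar ℓ (M i))))
    (¬¬-map OR-holds (¬¬-ZeroAt-everywhere unforced))
  where
  OR-holds : (∀ i → ZeroAt A i) → T (OR k (λ i → NotPar ℓ (M i)))
  OR-holds zeros = anyTrue-mono row-holds (idPol (pad d M) (pad-columns (T ∘ A) d M d∈A M∈A))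
    where
    d : Fin k → BitVec k
    d = proj₁ ∘ zeros

    d∈A : ∀ i → T (A (d i))
    d∈A = proj₁ ∘ proj₂ ∘ zeros

    row-not-allTrue : ∀ i → allTrue (k * 2 + ℓ) (pad d M i) ≡ false
    row-not-allTrue i =
      allTrue-false (pad d M i) (pad-index {ℓ = ℓ} i)
        (trans (pad-at-index d M i i) (proj₂ (proj₂ (zeros i))))

    row-holds : ∀ i → T (idF (k * 2 + ℓ) (NotPar (k * 2 + ℓ)) (pad d M i)) → T (NotPar ℓ (M i))
    row-holds i = subst T (cong not (Par-pad d M i))
                ∘ T-idF⇒T (k * 2 + ℓ) (NotPar (k * 2 + ℓ)) (pad d M i) (row-not-allTrue i)

lemma4p7 : (k : ℕ) → (A : Subset01 k) → IsPredicate A → ¬ HasForced1 A →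
    ((N : ℕ) → Σ ℕ λ ℓ → N ≤ ℓ × Odd ℓ × InPolF A (OR k) ℓ (idF ℓ (NotPar ℓ))) →
    ((N : ℕ) → Σ ℕ λ ℓ → N ≤ ℓ × Odd ℓ × InPolF A (OR k) ℓ (NotPar ℓ))
lemma4p7 k A _ unforced idNotPar-pols N with idNotPar-pols (k * 2 + N)
... | ℓ , k*2+N≤ℓ , ℓ-odd , idPol , _ with +-≤-split (k * 2) k*2+N≤ℓ
... | ℓ′ , refl , N≤ℓ′ =
  ℓ′ , N≤ℓ′ , ℓ′-odd , NotPar-polymorphism ℓ′ unforced idPol , NotPar-folded ℓ′-odd
  where
  ℓ′-odd : Odd ℓ′
  ℓ′-odd = Odd-*2+⁻ k ℓ-odd
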